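{- Let $B\colon\mathsf{Set}\to\mathsf{Set}$ be a polynomial functor with final coalgebra $(B_\omega,\zeta)$, let $F\colon\mathsf{Set}\to\mathsf{Set}$ be a functor and $\alpha\colon FB_\omega\to B_\omega$ a causal algebra. Then coinduction up to $\alpha$ is valid: for every set $X$ and map $g\colon X\to BFX$ there exists a unique $\hat g\colon X\to B_\omega$ such that $\zeta\circ\hat g=B\alpha\circ BF\hat g\circ g$.
   Context: $B$ is polynomial if isomorphic to $X\mapsto\coprod_{a\in I}X^{E_a}$ for some family of sets $(E_a)_{a\in I}$. Final sequence: $B_0=1$, $B_{i+1}=BB_i$, $B_j=\lim_{i<j}B_i$ for limit $j$, with connecting maps $B_{j,i}\colon B_j\to B_i$, $B_{i,i}=\mathrm{id}$, $B_{j+1,i+1}=BB_{j,i}$; for polynomial $B$, $B_\omega$ carries the final coalgebra. An algebra $\alpha\colon FB_\omega\to B_\omega$ is causal if for every set $X$, all $f,g\colon X\to B_\omega$ and every $i<\omega$, $B_{\omega,i}\circ f=B_{\omega,i}\circ g$ implies $B_{\omega,i}\circ\alpha\circ Ff=B_{\omega,i}\circ\alpha\circ Fg$. -}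

module Defs where

open import Level using (0ℓ)
open import Data.Nat.Base using (ℕ; zero; suc)
open import Data.Unit.Base using (⊤; tt)
open import Data.Product.Base using (Σ; _,_; proj₁; proj₂)
open import Data.Container.Core using (Container; ⟦_⟧; map)
open import Data.Container.Relation.Binary.Pointwise using (Pointwise; _,_)
open import Relation.Binary.PropositionalEquality
  using (_≡_; refl; sym; trans; subst; cong)

-- Functors on Set.  Equalities of functions are stated pointwise
-- (no function extensionality is available in Agda).

record SetFunctor : Set₁ where
  field
    F₀        : Set → Set
    fmap      : {X Y : Set} → (X → Y) → F₀ X → F₀ Y
    fmap-cong : {X Y : Set} {f g : X → Y} →
                (∀ x → f x ≡ g x) → ∀ u → fmap f u ≡ fmap g u
    fmap-id   : {X : Set} (u : F₀ X) → fmap (λ x → x) u ≡ u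
    fmap-∘    : {X Y Z : Set} (f : X → Y) (g : Y → Z) (u : F₀ X) →
                fmap (λ x → g (f x)) u ≡ fmap g (fmap f u)

-- A polynomial functor B X = ∐_{a ∈ I} X^{E a} is a container
-- (Shape = I, Position = E); ⟦ C ⟧ is B and map is its action.

module Final (C : Container 0ℓ 0ℓ) where

  B : Set → Set
  B X = ⟦ C ⟧ X

  Bmap : {X Y : Set} → (X → Y) → B X → B Y
  Bmap = map

  Bseq : ℕ → Set
  Bseq zero    = ⊤
  Bseq (suc n) = B (Bseq n)

  step : (n : ℕ) → Bseq (suc n) → Bseq n
  step zero    _ = tt
  step (suc n) x = Bmap (step n) x

  Eq : (n : ℕ) → Bseq n → Bseq n → Set
  Eq zero    _ _ = ⊤
  Eq (suc n) x y = Pointwise C (Eq n) x y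

  -- B_ω = lim_{i<ω} B_i : compatible sequences
  Bω : Set
  Bω = Σ ((n : ℕ) → Bseq n) λ x → (n : ℕ) → Eq n (step n (x (suc n))) (x n)

  π : (n : ℕ) → Bω → Bseq n
  π n x = proj₁ x n

  _≈ω_ : Bω → Bω → Set
  x ≈ω y = (n : ℕ) → Eq n (π n x) (π n y)

  _≈Bω_ : B Bω → B Bω → Set
  u ≈Bω v = Pointwise C _≈ω_ u v

  -- the final coalgebra structure ζ : B_ω → B B_ω
  -- (inverse of the canonical iso B B_ω ≅ B_ω, i.e. B π_n ∘ ζ = π_{n+1})

  Eq-refl : ∀ n (x : Bseq n) → Eq n x x
  Eq-refl zero    x       = tt
  Eq-refl (suc n) (a , f) = refl , λ e → Eq-refl n (f e)

  private

    Eq-≡ : ∀ n {x y z : Bseq n} → Eq n x y → y ≡ z → Eq n x z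
    Eq-≡ n r refl = r

    subst-lemma : {a b c : Container.Shape C} (r : b ≡ c) (q : c ≡ a)
                  (e : Container.Position C a) →
                  subst (Container.Position C) r
                    (subst (Container.Position C) (sym (trans r q)) e)
                  ≡ subst (Container.Position C) (sym q) e
    subst-lemma refl refl e = refl

  module _ (x : Bω) where
    private
      s : ℕ → Container.Shape C
      s n = proj₁ (proj₁ x (suc n))

      idx : (n : ℕ) → s n ≡ s zero
      idx zero    = refl
      idx (suc n) = trans (Pointwise.shape (proj₂ x (suc n))) (idx n)

      child : Container.Position C (s zero) → (n : ℕ) → Bseq n
      child e n = proj₂ (proj₁ x (suc n))
                    (subst (Container.Position C) (sym (idx n)) e)

      child-coh : (e : Container.Position C (s zero)) (n : ℕ) →
                  Eq n (step n (child e (suc n))) (child e n)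
      child-coh e n =
        Eq-≡ n (Pointwise.position (proj₂ x (suc n))
                  (subst (Container.Position C) (sym (idx (suc n))) e))
               (cong (proj₂ (proj₁ x (suc n)))
                  (subst-lemma (Pointwise.shape (proj₂ x (suc n))) (idx n) e))

    ζ : B Bω
    ζ = s zero , λ e → child e , child-coh e

  module _ (F : SetFunctor) where
    open SetFunctor F

    IsCausal : (F₀ Bω → Bω) → Set₁
    IsCausal α = (X : Set) (f g : X → Bω) (i : ℕ) →
                 (∀ x → Eq i (π i (f x)) (π i (g x))) →
                 ∀ u → Eq i (π i (α (fmap f u))) (π i (α (fmap g u)))

    SolvesEq : (α : F₀ Bω → Bω) {X : Set} (g : X → B (F₀ X)) (h : X → Bω) → Set
    SolvesEq α g h = ∀ x → ζ (h x) ≈Bω Bmap α (Bmap (fmap h) (g x))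

-- The proof is a Banach-style fixed-point argument on maps X → B_ω,
-- where two elements of B_ω are "n-close" when their projections to the
-- stage B_n of the final sequence agree.
module Submission where

open import Defs
open import Level using (0ℓ)
open import Data.Nat.Base using (ℕ; zero; suc)
open import Data.Unit.Base using (tt)
open import Data.Product.Base using (Σ; _×_; _,_; proj₁; proj₂)
open import Data.Container.Core using (Container)
open import Data.Container.Relation.Binary.Pointwise using (Pointwise; _,_)
open import Relation.Binary.PropositionalEquality
  using (_≡_; refl; sym; trans; subst; cong)
open import Axiom.UniquenessOfIdentityProofs.WithK using (uip)

module Approximation (C : Container 0ℓ 0ℓ) where
  open Final C
  open Container C renaming (Shape to S; Position to P)

  Eq-reflexive : ∀ n {x y : Bseq n} → x ≡ y → Eq n x y
  Eq-reflexive n {x} refl = Eq-refl n x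

  Eq-sym : ∀ n {x y : Bseq n} → Eq n x y → Eq n y x
  Eq-sym zero    _          = tt
  Eq-sym (suc n) (refl , p) = refl , λ e → Eq-sym n (p e)

  Eq-trans : ∀ n {x y z : Bseq n} → Eq n x y → Eq n y z → Eq n x z
  Eq-trans zero    _          _          = tt
  Eq-trans (suc n) (refl , p) (refl , q) = refl , λ e → Eq-trans n (p e) (q e)

  _≈[_]_ : Bω → ℕ → Bω → Set
  x ≈[ n ] y = Eq n (π n x) (π n y)

  subst-irrelevant : ∀ {a b} (p q : a ≡ b) (e : P a) → subst P p e ≡ subst P q e
  subst-irrelevant p q e = cong (λ r → subst P r e) (uip p q)

  shape-stable : (y : Bω) (n : ℕ) → proj₁ (π (suc n) y) ≡ proj₁ (π 1 y)
  shape-stable y zero    = refl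
  shape-stable y (suc n) = trans (Pointwise.shape (proj₂ y (suc n))) (shape-stable y n)

  ζ-approx : ∀ n (y : Bω) → Eq (suc n) (Bmap (π n) (ζ y)) (π (suc n) y)
  ζ-approx n y = sym (shape-stable y n) , λ e →
    Eq-reflexive n (cong (proj₂ (π (suc n) y))
      (subst-irrelevant _ (sym (shape-stable y n)) e))

  ζ⁻¹ : B Bω → Bω
  ζ⁻¹ u = approx , coherent
    where
    approx : (n : ℕ) → Bseq n
    approx zero    = tt
    approx (suc n) = proj₁ u , λ e → π n (proj₂ u e)
    coherent : (n : ℕ) → Eq n (step n (approx (suc n))) (approx n)
    coherent zero    = tt
    coherent (suc n) = refl , λ e → proj₂ (proj₂ u e) n

  ≈Bω-from-levels : {v w : B Bω} →
    (∀ n → Eq (suc n) (Bmap (π n) v) (Bmap (π n) w)) → v ≈Bω w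
  ≈Bω-from-levels {v} {w} close = Pointwise.shape (close 0) , λ e n →
    let (shape , position) = close n in
    subst (λ e′ → Eq n (π n (proj₂ v e)) (π n (proj₂ w e′)))
      (subst-irrelevant shape (Pointwise.shape (close 0)) e) (position e)

  ζ-transpose : (y : Bω) (u : B Bω) → y ≈ω ζ⁻¹ u → ζ y ≈Bω u
  ζ-transpose y u y≈ = ≈Bω-from-levels λ n →
    Eq-trans (suc n) (ζ-approx n y) (y≈ (suc n))

  ζ-untranspose : (y : Bω) (u : B Bω) → ζ y ≈Bω u → y ≈ω ζ⁻¹ u
  ζ-untranspose y u ζy≈ zero    = tt
  ζ-untranspose y u ζy≈ (suc n) =
    Eq-trans (suc n) (Eq-sym (suc n) (ζ-approx n y))
      (Pointwise.shape ζy≈ , λ e → Pointwise.position ζy≈ e n)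

  constant : S → Bω
  constant a = approx , coherent
    where
    approx : (n : ℕ) → Bseq n
    approx zero    = tt
    approx (suc n) = a , λ _ → approx n
    coherent : (n : ℕ) → Eq n (step n (approx (suc n))) (approx n)
    coherent zero    = tt
    coherent (suc n) = refl , λ _ → coherent n

module Contraction (C : Container 0ℓ 0ℓ) {X : Set}
    (Φ : (X → Final.Bω C) → X → Final.Bω C)
    (contractive : ∀ n (h h′ : X → Final.Bω C) →
       (∀ y → Approximation._≈[_]_ C (h y) n (h′ y)) →
       ∀ x → Approximation._≈[_]_ C (Φ h x) (suc n) (Φ h′ x))
    (seed : X → Final.Bω C) where
  open Final C
  open Approximation C

  IsFixed : (X → Bω) → Set
  IsFixed h = ∀ x → h x ≈ω Φ h x

  iterate : ℕ → X → Bω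
  iterate zero    = seed
  iterate (suc n) = Φ (iterate n)

  iterate-cauchy : ∀ n x → iterate (suc n) x ≈[ n ] iterate n x
  iterate-cauchy zero    x = tt
  iterate-cauchy (suc n) x = contractive n _ _ (iterate-cauchy n) x

  fixpoint : X → Bω
  fixpoint x = (λ n → π n (iterate n x)) , λ n →
    Eq-trans n (proj₂ (iterate (suc n) x) n) (iterate-cauchy n x)

  -- Its (n+1)-st approximant is that of Φ (iterate n), which contractivity
  -- relates to Φ fixpoint since iterate n and fixpoint are n-close.
  fixpoint-fixed : IsFixed fixpoint
  fixpoint-fixed x zero    = tt
  fixpoint-fixed x (suc n) =
    contractive n (iterate n) fixpoint (λ y → Eq-refl n (π n (iterate n y))) x

  -- Two fixed points that are n-close are (n+1)-close, hence equal.
  fixed-unique : ∀ {h h′} → IsFixed h → IsFixed h′ → ∀ x → h x ≈ω h′ x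
  fixed-unique fix fix′ x zero    = tt
  fixed-unique fix fix′ x (suc n) =
    Eq-trans (suc n) (fix x (suc n))
      (Eq-trans (suc n) (contractive n _ _ (λ y → fixed-unique fix fix′ y n) x)
        (Eq-sym (suc n) (fix′ x (suc n))))

module CoinductionUpTo (C : Container 0ℓ 0ℓ) (F : SetFunctor)
    (α : SetFunctor.F₀ F (Final.Bω C) → Final.Bω C) (causal : Final.IsCausal C F α)
    (X : Set) (g : X → Final.B C (SetFunctor.F₀ F X)) where
  open Final C
  open SetFunctor F
  open Approximation C

  Φ : (X → Bω) → X → Bω
  Φ h x = ζ⁻¹ (Bmap α (Bmap (fmap h) (g x)))

  -- Causality of α: the new top layer comes from g, and below it α
  -- preserves n-closeness.
  Φ-contractive : ∀ n (h h′ : X → Bω) → (∀ y → h y ≈[ n ] h′ y) →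
                  ∀ x → Φ h x ≈[ suc n ] Φ h′ x
  Φ-contractive n h h′ close x = refl , λ e → causal X h h′ n close (proj₂ (g x) e)

  -- Constant trees with the shape produced by g provide a seed for iteration.
  open Contraction C Φ Φ-contractive (λ x → constant (proj₁ (g x))) public

  fixed⇒solves : ∀ {h} → IsFixed h → SolvesEq F α g h
  fixed⇒solves fix x = ζ-transpose _ _ (fix x)

  solves⇒fixed : ∀ {h} → SolvesEq F α g h → IsFixed h
  solves⇒fixed sol x = ζ-untranspose _ _ (sol x)

theorem9p2 : (C : Container 0ℓ 0ℓ) (F : SetFunctor)
    (α : SetFunctor.F₀ F (Final.Bω C) → Final.Bω C) → Final.IsCausal C F α →
    (X : Set) (g : X → Final.B C (SetFunctor.F₀ F X)) →
    Σ (X → Final.Bω C) λ ĝ →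
    Final.SolvesEq C F α g ĝ
    × ((h : X → Final.Bω C) → Final.SolvesEq C F α g h →
    ∀ x → Final._≈ω_ C (h x) (ĝ x))
theorem9p2 C F α causal X g =
  fixpoint , fixed⇒solves fixpoint-fixed ,
  λ h sol → fixed-unique (solves⇒fixed sol) fixpoint-fixed
  where open CoinductionUpTo C F α causal X g
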